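{- Let $G=([n],E)$ be the complete graph. There exists a distribution $\mathcal D$ on $\{0,1\}^{|E|}$ that is $3$-wise independent with marginals $1/4$ such that a subgraph of $G$ sampled according to $\mathcal D$ is disconnected with probability at least $1-2^{1-n}$.
   Context: A distribution on $\{0,1\}^m$ is $k$-wise independent with marginals $p$ if its restriction to any at most $k$ coordinates is distributed as independent Bernoulli bits with means given by $p$. Sampling a subgraph according to $\mathcal D$ means drawing $x\sim\mathcal D$ and keeping exactly the edges $e$ with $x_e=1$. -}

module Defs where

open import Data.Nat as ℕ using (ℕ; zero; suc)
open import Data.Fin as Fin using (Fin)
open import Data.Bool using (Bool; true; false; if_then_else_)
open import Data.Integer using (+_)
open import Data.Rational using (ℚ; 0ℚ; 1ℚ; ½; _/_; _+_; _*_; _-_; _≤_)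
open import Data.List using (List; []; _∷_; map; foldr; length; lookup)
open import Data.List.Relation.Unary.All using (All)
open import Data.List.Relation.Unary.Unique.Propositional using (Unique)
open import Data.Product using (Σ; Σ-syntax; ∃; _×_; _,_; proj₁; proj₂)
open import Data.Sum using (_⊎_)
open import Relation.Binary.PropositionalEquality using (_≡_)
open import Relation.Nullary using (¬_)

-- Edges of the complete graph K_n on vertex set [n] = Fin n:
-- unordered pairs {i,j}, represented canonically as (i , j) with i < j.
Edge : ℕ → Set
Edge n = Σ[ i ∈ Fin n ] Σ[ j ∈ Fin n ] i Fin.< j

Outcome : ℕ → Set
Outcome n = Edge n → Bool

-- A (finitely supported) probability distribution on {0,1}^E, given as a
-- list of (weight , outcome) atoms; weights nonnegative and summing to 1.
Dist : ℕ → Set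
Dist n = List (ℚ × Outcome n)

sumℚ : List ℚ → ℚ
sumℚ = foldr _+_ 0ℚ

prodℚ : List ℚ → ℚ
prodℚ = foldr _*_ 1ℚ

IsDistribution : ∀ {n} → Dist n → Set
IsDistribution D = All (λ a → 0ℚ ≤ proj₁ a) D × sumℚ (map proj₁ D) ≡ 1ℚ

agrees : ∀ {n} → Outcome n → List (Edge n × Bool) → Bool
agrees x [] = true
agrees x ((e , b) ∷ s) with x e | b
... | true  | true  = agrees x s
... | false | false = agrees x s
... | _     | _     = false

PrPattern : ∀ {n} → Dist n → List (Edge n × Bool) → ℚ
PrPattern D s = sumℚ (map (λ a → if agrees (proj₂ a) s then proj₁ a else 0ℚ) D)

bern : ℚ → Bool → ℚ
bern p true  = p
bern p false = 1ℚ - p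

KWiseIndependent : ∀ {n} → ℕ → ℚ → Dist n → Set
KWiseIndependent {n} k p D =
  (s : List (Edge n × Bool)) →
  Unique (map proj₁ s) →
  length s ℕ.≤ k →
  PrPattern D s ≡ prodℚ (map (λ eb → bern p (proj₂ eb)) s)

Adj : ∀ {n} → Outcome n → Fin n → Fin n → Set
Adj x u v = (Σ[ p ∈ u Fin.< v ] x (u , v , p) ≡ true)
          ⊎ (Σ[ p ∈ v Fin.< u ] x (v , u , p) ≡ true)

data Reach {n} (x : Outcome n) : Fin n → Fin n → Set where
  here : ∀ {u} → Reach x u u
  step : ∀ {u v w} → Adj x u v → Reach x v w → Reach x u w

Connected : ∀ {n} → Outcome n → Set
Connected {n} x = (u v : Fin n) → Reach x u v

Disconnected : ∀ {n} → Outcome n → Set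
Disconnected x = ¬ Connected x

-- Pr_{x∼D}[P x] ≥ q : there is a set of atoms of D, all satisfying P,
-- whose total weight is at least q.
PrAtLeast : ∀ {n} → Dist n → (Outcome n → Set) → ℚ → Set
PrAtLeast D P q =
  Σ[ keep ∈ (Fin (length D) → Bool) ]
    ((i : Fin (length D)) → keep i ≡ true → P (proj₂ (lookup D i)))
    × (q ≤ sumℚ (Data.List.tabulate (λ i → if keep i then proj₁ (lookup D i) else 0ℚ)))

half^ : ℕ → ℚ
half^ zero    = 1ℚ
half^ (suc n) = ½ * half^ n

bound : ℕ → ℚ
bound n = 1ℚ - (+ 2 / 1) * half^ n

quarter : ℚ
quarter = + 1 / 4

-- Give every vertex an independent uniform label (z, y) ∈ {0,1}², draw an independent bit b
-- with Pr[b = 1] = 1/4, and keep the edge uv iff z_u = z_v and y_u ⊕ y_v ⊕ b = 1.  Whatever the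
-- label of v, exactly one of the four labels of u keeps uv, so every edge has probability 1/4.
-- In a set of at most three distinct edges that is not a triangle, some edge has an endpoint
-- met by no other edge; resampling that endpoint's label splits the edge off independently of
-- the rest, already for fixed b.  For a triangle the three y-conditions xor to b, and averaging
-- over b with weights 1/4, 3/4 gives exactly the product probabilities.  Every kept edge joins
-- vertices with equal z, so the graph is disconnected unless z is constant, which happens with
-- probability 2 · 2⁻ⁿ.
module Submission where

open import Defs
open import Data.Nat as ℕ using (ℕ; zero; suc; s≤s)
open import Data.Fin as Fin using (Fin; zero; suc)
open import Data.Fin.Properties using (_≟_; <⇒≢; <-irrelevant; <-asym)
open import Data.Bool using (Bool; true; false; not; _∧_; _xor_; if_then_else_)
open import Data.Bool.Properties using (xor-comm; xor-assoc; ∧-zeroʳ)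
open import Data.Integer as ℤ using ()
open import Data.Rational using (ℚ; 0ℚ; 1ℚ; ½; _/_; _+_; _-_; _*_; _≤_; NonNegative)
open import Data.Rational.Properties
  using (*-assoc; *-zeroˡ; *-zeroʳ; *-identityˡ; *-identityʳ; *-distribˡ-+; +-identityˡ;
         +-identityʳ; +-assoc; *-monoˡ-≤-nonNeg; ≤-reflexive; _≤?_; *-1-commutativeMonoid)
open import Data.Rational.Solver using (module +-*-Solver)
open import Algebra.Bundles using (CommutativeMonoid)
open import Algebra.Properties.CommutativeSemigroup
  (CommutativeMonoid.commutativeSemigroup *-1-commutativeMonoid) using (x∙yz≈y∙xz)
open import Data.List using (List; []; _∷_; map; _++_; length; lookup; tabulate)
open import Data.List.Properties using (map-∘; map-cong)
open import Data.List.Relation.Unary.All as All using (All; []; _∷_)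
open import Data.List.Relation.Unary.All.Properties using (map⁺; ++⁺)
open import Data.List.Relation.Unary.AllPairs using ([]; _∷_)
open import Data.List.Relation.Unary.Unique.Propositional using (Unique)
open import Data.Product as Product
  using (Σ-syntax; ∃-syntax; _×_; _,_; proj₁; proj₂; uncurry)
open import Data.Sum using (_⊎_; inj₁; inj₂)
open import Data.Empty using (⊥-elim)
open import Data.Vec.Functional using (Vector; head; tail) renaming ([] to ⟨⟩; _∷_ to _◂_)
open import Function using (_∘_; case_of_)
open import Relation.Nullary using (¬_; Dec; yes; no)
open import Relation.Nullary.Decidable using (_⊎-dec_; toWitness)
open import Relation.Binary.PropositionalEquality

open +-*-Solver

Label : Set
Label = Bool × Bool

ℓ₀₀ ℓ₀₁ ℓ₁₀ ℓ₁₁ : Label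
ℓ₀₀ = false , false
ℓ₀₁ = false , true
ℓ₁₀ = true , false
ℓ₁₁ = true , true

-- Kept opaque so that unification compares avg f with avg g instead of their four-term sums.
opaque
  avg : (Label → ℚ) → ℚ
  avg f = quarter * (f ℓ₀₀ + (f ℓ₀₁ + (f ℓ₁₀ + f ℓ₁₁)))

  avg-cong : ∀ {f g : Label → ℚ} → (∀ ℓ → f ℓ ≡ g ℓ) → avg f ≡ avg g
  avg-cong f≗g =
    cong₂ (λ a b → quarter * (a + b)) (f≗g _)
      (cong₂ _+_ (f≗g _) (cong₂ _+_ (f≗g _) (f≗g _)))

  avg-const : ∀ c → avg (λ _ → c) ≡ c
  avg-const = solve 1 (λ c → con quarter :* (c :+ (c :+ (c :+ c))) := c) refl

  avg-+ : ∀ (f g : Label → ℚ) → avg (λ ℓ → f ℓ + g ℓ) ≡ avg f + avg g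
  avg-+ f g = solve 8 (λ a b c d a' b' c' d' →
      con quarter :* ((a :+ a') :+ ((b :+ b') :+ ((c :+ c') :+ (d :+ d'))))
      := con quarter :* (a :+ (b :+ (c :+ d))) :+ con quarter :* (a' :+ (b' :+ (c' :+ d')))) refl
    (f ℓ₀₀) (f ℓ₀₁) (f ℓ₁₀) (f ℓ₁₁) (g ℓ₀₀) (g ℓ₀₁) (g ℓ₁₀) (g ℓ₁₁)

  avg-*ˡ : ∀ c (f : Label → ℚ) → avg (λ ℓ → c * f ℓ) ≡ c * avg f
  avg-*ˡ c f = solve 5 (λ c a b d e →
      con quarter :* (c :* a :+ (c :* b :+ (c :* d :+ c :* e)))
      := c :* (con quarter :* (a :+ (b :+ (d :+ e))))) refl
    c (f ℓ₀₀) (f ℓ₀₁) (f ℓ₁₀) (f ℓ₁₁)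

  avg-*ʳ : ∀ (f : Label → ℚ) c → avg (λ ℓ → f ℓ * c) ≡ avg f * c
  avg-*ʳ f c = solve 5 (λ c a b d e →
      con quarter :* (a :* c :+ (b :* c :+ (d :* c :+ e :* c)))
      := con quarter :* (a :+ (b :+ (d :+ e))) :* c) refl
    c (f ℓ₀₀) (f ℓ₀₁) (f ℓ₁₀) (f ℓ₁₁)

  avg-comm : ∀ (f : Label → Label → ℚ) →
    avg (λ ℓ → avg (f ℓ)) ≡ avg (λ ℓ' → avg (λ ℓ → f ℓ ℓ'))
  avg-comm f =
    trans (avg-*ˡ quarter (λ ℓ → f ℓ ℓ₀₀ + (f ℓ ℓ₀₁ + (f ℓ ℓ₁₀ + f ℓ ℓ₁₁))))
          (cong (quarter *_) (trans (avg-+ (col ℓ₀₀) (λ ℓ → col ℓ₀₁ ℓ + (col ℓ₁₀ ℓ + col ℓ₁₁ ℓ)))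
          (cong (avg (col ℓ₀₀) +_) (trans (avg-+ (col ℓ₀₁) (λ ℓ → col ℓ₁₀ ℓ + col ℓ₁₁ ℓ))
          (cong (avg (col ℓ₀₁) +_) (avg-+ (col ℓ₁₀) (col ℓ₁₁)))))))
    where
    col : Label → Label → ℚ
    col ℓ' ℓ = f ℓ ℓ'

Labelling : ℕ → Set
Labelling = Vector Label

𝔼 : ∀ n → (Labelling n → ℚ) → ℚ
𝔼 zero    F = F ⟨⟩
𝔼 (suc n) F = avg (λ ℓ → 𝔼 n (λ a → F (ℓ ◂ a)))

𝔼-cong : ∀ n {F G : Labelling n → ℚ} → (∀ a → F a ≡ G a) → 𝔼 n F ≡ 𝔼 n G
𝔼-cong zero    F≗G = F≗G ⟨⟩
𝔼-cong (suc n) F≗G = avg-cong (λ ℓ → 𝔼-cong n (λ a → F≗G (ℓ ◂ a)))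

𝔼-const : ∀ n c → 𝔼 n (λ _ → c) ≡ c
𝔼-const zero    c = refl
𝔼-const (suc n) c = trans (avg-cong (λ _ → 𝔼-const n c)) (avg-const c)

𝔼-+ : ∀ n (F G : Labelling n → ℚ) → 𝔼 n (λ a → F a + G a) ≡ 𝔼 n F + 𝔼 n G
𝔼-+ zero    F G = refl
𝔼-+ (suc n) F G = trans (avg-cong (λ ℓ → 𝔼-+ n _ _)) (avg-+ _ _)

𝔼-*ˡ : ∀ n c (F : Labelling n → ℚ) → 𝔼 n (λ a → c * F a) ≡ c * 𝔼 n F
𝔼-*ˡ zero    c F = refl
𝔼-*ˡ (suc n) c F = trans (avg-cong (λ ℓ → 𝔼-*ˡ n c _)) (avg-*ˡ c _)

𝔼-avg : ∀ n (F : Label → Labelling n → ℚ) →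
  𝔼 n (λ a → avg (λ ℓ → F ℓ a)) ≡ avg (λ ℓ → 𝔼 n (F ℓ))
𝔼-avg zero    F = refl
𝔼-avg (suc n) F = trans (avg-cong (λ ℓ → 𝔼-avg n _)) (avg-comm _)

-- Rebuilt with _◂_ (rather than updateAt) so that relabel (ℓ ◂ a) u ℓ' reduces to a cons:
-- this is what lets 𝔼-resample go through without function extensionality.
relabel : ∀ {n} → Labelling n → Fin n → Label → Labelling n
relabel a zero    ℓ = ℓ ◂ tail a
relabel a (suc u) ℓ = head a ◂ relabel (tail a) u ℓ

relabel-same : ∀ {n} (a : Labelling n) u ℓ → relabel a u ℓ u ≡ ℓ
relabel-same a zero    ℓ = refl
relabel-same a (suc u) ℓ = relabel-same (tail a) u ℓ

relabel-other : ∀ {n} (a : Labelling n) {u v} ℓ → u ≢ v → relabel a u ℓ v ≡ a v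
relabel-other a {zero}  {zero}  ℓ u≢v = ⊥-elim (u≢v refl)
relabel-other a {zero}  {suc v} ℓ u≢v = refl
relabel-other a {suc u} {zero}  ℓ u≢v = refl
relabel-other a {suc u} {suc v} ℓ u≢v = relabel-other (tail a) ℓ (u≢v ∘ cong suc)

𝔼-resample : ∀ n u (F : Labelling n → ℚ) →
  𝔼 n F ≡ avg (λ ℓ → 𝔼 n (λ a → F (relabel a u ℓ)))
𝔼-resample (suc n) zero    F = sym (avg-cong (λ ℓ → avg-const _))
𝔼-resample (suc n) (suc u) F =
  trans (avg-cong (λ ℓ → 𝔼-resample n u (λ a → F (ℓ ◂ a)))) (avg-comm _)

𝔼-split-at : ∀ n u {F : Labelling n → ℚ} (H : Label → Labelling n → ℚ) →
  (∀ a ℓ → F (relabel a u ℓ) ≡ H ℓ a) → 𝔼 n F ≡ avg (λ ℓ → 𝔼 n (H ℓ))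
𝔼-split-at n u {F} H F≗H =
  trans (𝔼-resample n u F) (avg-cong (λ ℓ → 𝔼-cong n (λ a → F≗H a ℓ)))

𝔼-factor : ∀ n {x v} (h : Label → Label → ℚ) k (G : Labelling n → ℚ) → x ≢ v →
  (∀ c → avg (λ ℓ → h ℓ c) ≡ k) → (∀ a ℓ → G (relabel a x ℓ) ≡ G a) →
  𝔼 n (λ a → h (a x) (a v) * G a) ≡ k * 𝔼 n G
𝔼-factor n {x} {v} h k G x≢v avg-h G-ignores-x = begin
  𝔼 n (λ a → h (a x) (a v) * G a)          ≡⟨ 𝔼-split-at n x H relabelled ⟩
  avg (λ ℓ → 𝔼 n (H ℓ))                    ≡⟨ 𝔼-avg n H ⟨
  𝔼 n (λ a → avg (λ ℓ → H ℓ a))            ≡⟨ 𝔼-cong n averaged ⟩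
  𝔼 n (λ a → k * G a)                      ≡⟨ 𝔼-*ˡ n k G ⟩
  k * 𝔼 n G                                ∎
  where
  open ≡-Reasoning
  H : Label → Labelling n → ℚ
  H ℓ a = h ℓ (a v) * G a
  relabelled : ∀ a ℓ → h (relabel a x ℓ x) (relabel a x ℓ v) * G (relabel a x ℓ) ≡ H ℓ a
  relabelled a ℓ rewrite relabel-same a x ℓ | relabel-other a ℓ x≢v | G-ignores-x a ℓ = refl
  averaged : ∀ a → avg (λ ℓ → H ℓ a) ≡ k * G a
  averaged a = trans (avg-*ʳ (λ ℓ → h ℓ (a v)) (G a)) (cong (_* G a) (avg-h (a v)))

𝔼-three : ∀ n {u v w} (T : Label → Label → Label → ℚ) → u ≢ v → v ≢ w → u ≢ w →
  𝔼 n (λ a → T (a u) (a v) (a w)) ≡ avg (λ ℓ₁ → avg (λ ℓ₂ → avg (λ ℓ₃ → T ℓ₁ ℓ₂ ℓ₃)))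
𝔼-three n {u} {v} {w} T u≢v v≢w u≢w =
  trans (𝔼-split-at n u _ fix-u) (avg-cong λ ℓ₁ →
  trans (𝔼-split-at n v _ (fix-v ℓ₁)) (avg-cong λ ℓ₂ →
  trans (𝔼-split-at n w _ (fix-w ℓ₁ ℓ₂)) (avg-cong λ ℓ₃ →
  𝔼-const n (T ℓ₁ ℓ₂ ℓ₃))))
  where
  fix-u : ∀ a ℓ₁ → T (relabel a u ℓ₁ u) (relabel a u ℓ₁ v) (relabel a u ℓ₁ w) ≡ T ℓ₁ (a v) (a w)
  fix-u a ℓ₁
    rewrite relabel-same a u ℓ₁ | relabel-other a ℓ₁ u≢v | relabel-other a ℓ₁ u≢w = refl
  fix-v : ∀ ℓ₁ a ℓ₂ → T ℓ₁ (relabel a v ℓ₂ v) (relabel a v ℓ₂ w) ≡ T ℓ₁ ℓ₂ (a w)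
  fix-v ℓ₁ a ℓ₂ rewrite relabel-same a v ℓ₂ | relabel-other a ℓ₂ v≢w = refl
  fix-w : ∀ ℓ₁ ℓ₂ a ℓ₃ → T ℓ₁ ℓ₂ (relabel a w ℓ₃ w) ≡ T ℓ₁ ℓ₂ ℓ₃
  fix-w ℓ₁ ℓ₂ a ℓ₃ = cong (T ℓ₁ ℓ₂) (relabel-same a w ℓ₃)

_≐_ : Bool → Bool → Bool
x ≐ y = not (x xor y)

𝟙 : Bool → ℚ
𝟙 true  = 1ℚ
𝟙 false = 0ℚ

𝟙-∧ : ∀ x y → 𝟙 (x ∧ y) ≡ 𝟙 x * 𝟙 y
𝟙-∧ true  y = sym (*-identityˡ (𝟙 y))
𝟙-∧ false y = sym (*-zeroˡ (𝟙 y))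

𝟙-agrees-∷ : ∀ {n} (x : Outcome n) e β s →
  𝟙 (agrees x ((e , β) ∷ s)) ≡ 𝟙 (x e ≐ β) * 𝟙 (agrees x s)
𝟙-agrees-∷ x e β s with x e | β
... | true  | true  = sym (*-identityˡ (𝟙 (agrees x s)))
... | false | false = sym (*-identityˡ (𝟙 (agrees x s)))
... | true  | false = sym (*-zeroˡ (𝟙 (agrees x s)))
... | false | true  = sym (*-zeroˡ (𝟙 (agrees x s)))

𝟙-agrees-swap : ∀ {n} (x : Outcome n) p₁ p₂ s →
  𝟙 (agrees x (p₁ ∷ p₂ ∷ s)) ≡ 𝟙 (agrees x (p₂ ∷ p₁ ∷ s))
𝟙-agrees-swap x (e₁ , β₁) (e₂ , β₂) s = begin
  𝟙 (agrees x ((e₁ , β₁) ∷ (e₂ , β₂) ∷ s))    ≡⟨ expand e₁ β₁ e₂ β₂ ⟩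
  A₁ * (A₂ * 𝟙 (agrees x s))                   ≡⟨ x∙yz≈y∙xz A₁ A₂ (𝟙 (agrees x s)) ⟩
  A₂ * (A₁ * 𝟙 (agrees x s))                   ≡⟨ expand e₂ β₂ e₁ β₁ ⟨
  𝟙 (agrees x ((e₂ , β₂) ∷ (e₁ , β₁) ∷ s))    ∎
  where
  open ≡-Reasoning
  A₁ A₂ : ℚ
  A₁ = 𝟙 (x e₁ ≐ β₁)
  A₂ = 𝟙 (x e₂ ≐ β₂)
  expand : ∀ e β e' β' →
    𝟙 (agrees x ((e , β) ∷ (e' , β') ∷ s)) ≡ 𝟙 (x e ≐ β) * (𝟙 (x e' ≐ β') * 𝟙 (agrees x s))
  expand e β e' β' = trans (𝟙-agrees-∷ x e β _) (cong (𝟙 (x e ≐ β) *_) (𝟙-agrees-∷ x e' β' s))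

agrees-cong : ∀ {n} {x y : Outcome n} (s : List (Edge n × Bool)) →
  All (λ e → x e ≡ y e) (map proj₁ s) → agrees x s ≡ agrees y s
agrees-cong [] [] = refl
agrees-cong {x = x} {y} ((e , β) ∷ s) (x≡y ∷ rest) with x e | y e | x≡y | β
... | true  | .true  | refl | true  = agrees-cong s rest
... | true  | .true  | refl | false = refl
... | false | .false | refl | true  = refl
... | false | .false | refl | false = agrees-cong s rest

keep : Bool → Label → Label → Bool
keep b (z , y) (z' , y') = (z ≐ z') ∧ (y xor y' xor b)

keep-sym : ∀ b ℓ ℓ' → keep b ℓ ℓ' ≡ keep b ℓ' ℓ
keep-sym b (z , y) (z' , y') = cong₂ _∧_ (cong not (xor-comm z z')) (begin
  y xor y' xor b     ≡⟨ xor-assoc y y' b ⟨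
  (y xor y') xor b   ≡⟨ cong (_xor b) (xor-comm y y') ⟩
  (y' xor y) xor b   ≡⟨ xor-assoc y' y b ⟩
  y' xor y xor b     ∎)
  where open ≡-Reasoning

keep⇒same-z : ∀ b ℓ ℓ' → keep b ℓ ℓ' ≡ true → proj₁ ℓ ≡ proj₁ ℓ'
keep⇒same-z b (true  , y) (true  , y') _ = refl
keep⇒same-z b (false , y) (false , y') _ = refl

graphOf : ∀ {n} → Bool → Labelling n → Outcome n
graphOf b a (i , j , _) = keep b (a i) (a j)

_∈ₑ_ : ∀ {n} → Fin n → Edge n → Set
u ∈ₑ (i , j , _) = u ≡ i ⊎ u ≡ j

_∈ₑ?_ : ∀ {n} (u : Fin n) (e : Edge n) → Dec (u ∈ₑ e)
u ∈ₑ? (i , j , _) = (u ≟ i) ⊎-dec (u ≟ j)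

Fresh : ∀ {n} → Fin n → List (Edge n) → Set
Fresh x = All (λ e → ¬ x ∈ₑ e)

data Joins {n} : Edge n → Fin n → Fin n → Set where
  forward  : ∀ {i j} (i<j : i Fin.< j) → Joins (i , j , i<j) i j
  backward : ∀ {i j} (i<j : i Fin.< j) → Joins (i , j , i<j) j i

joins-sym : ∀ {n} {e : Edge n} {x v} → Joins e x v → Joins e v x
joins-sym (forward i<j)  = backward i<j
joins-sym (backward i<j) = forward i<j

joins-≢ : ∀ {n} {e : Edge n} {x v} → Joins e x v → x ≢ v
joins-≢ (forward i<j)  = <⇒≢ i<j
joins-≢ (backward i<j) = <⇒≢ i<j ∘ sym

joins-graphOf : ∀ {n} {e : Edge n} {x v} → Joins e x v →
  ∀ b a → graphOf b a e ≡ keep b (a x) (a v)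
joins-graphOf (forward _)  b a = refl
joins-graphOf {x = x} {v} (backward _) b a = keep-sym b (a v) (a x)

joins-unique : ∀ {n} {e e' : Edge n} {x v} → Joins e x v → Joins e' x v → e ≡ e'
joins-unique (forward p)  (forward q)  = cong (λ r → _ , _ , r) (<-irrelevant p q)
joins-unique (forward p)  (backward q) = ⊥-elim (<-asym p q)
joins-unique (backward p) (forward q)  = ⊥-elim (<-asym p q)
joins-unique (backward p) (backward q) = cong (λ r → _ , _ , r) (<-irrelevant p q)

∈ₑ⇒joins : ∀ {n} {e : Edge n} {u} → u ∈ₑ e → ∃[ w ] Joins e u w
∈ₑ⇒joins {e = i , j , i<j} (inj₁ refl) = j , forward i<j
∈ₑ⇒joins {e = i , j , i<j} (inj₂ refl) = i , backward i<j

joins-∈ₑ : ∀ {n} {e : Edge n} {v y u} → Joins e v y → u ∈ₑ e → u ≡ v ⊎ u ≡ y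
joins-∈ₑ (forward _)  u∈e = u∈e
joins-∈ₑ (backward _) (inj₁ u≡i) = inj₂ u≡i
joins-∈ₑ (backward _) (inj₂ u≡j) = inj₁ u≡j

joins-∉ₑ : ∀ {n} {e : Edge n} {v y x} → Joins e v y → x ≢ v → x ≢ y → ¬ x ∈ₑ e
joins-∉ₑ J x≢v x≢y x∈e with joins-∈ₑ J x∈e
... | inj₁ x≡v = x≢v x≡v
... | inj₂ x≡y = x≢y x≡y

joins-∈ₑ-both : ∀ {n} {e : Edge n} {x y} → x ∈ₑ e → y ∈ₑ e → x ≢ y → Joins e x y
joins-∈ₑ-both x∈e y∈e x≢y with ∈ₑ⇒joins x∈e
... | w , J with joins-∈ₑ J y∈e
...   | inj₁ y≡x = ⊥-elim (x≢y (sym y≡x))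
...   | inj₂ refl = J

data Meeting {n} (e₁ e₂ : Edge n) : Set where
  apart : ∀ {x v} → Joins e₁ x v → ¬ x ∈ₑ e₂ → ¬ v ∈ₑ e₂ → Meeting e₁ e₂
  touch : ∀ {x v y} → Joins e₁ x v → Joins e₂ v y → x ≢ y → Meeting e₁ e₂

meeting : ∀ {n} (e₁ e₂ : Edge n) → e₁ ≢ e₂ → Meeting e₁ e₂
meeting (i , j , i<j) e₂ e₁≢e₂ with i ∈ₑ? e₂ | j ∈ₑ? e₂
... | no i∉e₂ | no j∉e₂ = apart (forward i<j) i∉e₂ j∉e₂
... | yes i∈e₂ | _ with ∈ₑ⇒joins i∈e₂
...   | y , J = touch (backward i<j) J
                  λ { refl → e₁≢e₂ (sym (joins-unique J (forward i<j))) }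
meeting (i , j , i<j) e₂ e₁≢e₂ | no _ | yes j∈e₂ with ∈ₑ⇒joins j∈e₂
...   | y , J = touch (forward i<j) J
                  λ { refl → e₁≢e₂ (sym (joins-unique J (backward i<j))) }

touch-fresh : ∀ {n} {e₁ e₂ : Edge n} {x v y} →
  Joins e₁ x v → Joins e₂ v y → x ≢ y → ¬ x ∈ₑ e₂
touch-fresh J₁ J₂ x≢y = joins-∉ₑ J₂ (joins-≢ J₁) x≢y

distinct-pendant : ∀ {n} (e₁ e₂ : Edge n) → e₁ ≢ e₂ →
  ∃[ x ] ∃[ v ] Joins e₁ x v × ¬ x ∈ₑ e₂
distinct-pendant e₁ e₂ e₁≢e₂ with meeting e₁ e₂ e₁≢e₂
... | apart J x∉e₂ _ = _ , _ , J , x∉e₂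
... | touch J₁ J₂ x≢y = _ , _ , J₁ , touch-fresh J₁ J₂ x≢y

data Shape {n} (e₁ e₂ e₃ : Edge n) : Set where
  pendant₁ : ∀ {x v} → Joins e₁ x v → Fresh x (e₂ ∷ e₃ ∷ []) → Shape e₁ e₂ e₃
  pendant₂ : ∀ {y v} → Joins e₂ y v → Fresh y (e₁ ∷ e₃ ∷ []) → Shape e₁ e₂ e₃
  triangle : ∀ {x v y} → Joins e₁ x v → Joins e₂ v y → Joins e₃ x y → Shape e₁ e₂ e₃

shape : ∀ {n} (e₁ e₂ e₃ : Edge n) → e₁ ≢ e₂ → e₁ ≢ e₃ → Shape e₁ e₂ e₃
shape e₁ e₂ e₃ e₁≢e₂ e₁≢e₃ with meeting e₁ e₂ e₁≢e₂
... | apart {x} {v} J x∉e₂ v∉e₂ with x ∈ₑ? e₃ | v ∈ₑ? e₃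
...   | no x∉e₃  | _         = pendant₁ J (x∉e₂ ∷ x∉e₃ ∷ [])
...   | yes _    | no v∉e₃   = pendant₁ (joins-sym J) (v∉e₂ ∷ v∉e₃ ∷ [])
...   | yes x∈e₃ | yes v∈e₃  =
  ⊥-elim (e₁≢e₃ (joins-unique J (joins-∈ₑ-both x∈e₃ v∈e₃ (joins-≢ J))))
shape e₁ e₂ e₃ e₁≢e₂ e₁≢e₃ | touch {x} {v} {y} J₁ J₂ x≢y with x ∈ₑ? e₃ | y ∈ₑ? e₃
...   | no x∉e₃  | _         = pendant₁ J₁ (touch-fresh J₁ J₂ x≢y ∷ x∉e₃ ∷ [])
...   | yes _    | no y∉e₃   =
  pendant₂ (joins-sym J₂) (touch-fresh (joins-sym J₂) (joins-sym J₁) (x≢y ∘ sym) ∷ y∉e₃ ∷ [])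
...   | yes x∈e₃ | yes y∈e₃  = triangle J₁ J₂ (joins-∈ₑ-both x∈e₃ y∈e₃ x≢y)

opaque
  unfolding avg

  avg-keep : ∀ b c β → avg (λ ℓ → 𝟙 (keep b ℓ c ≐ β)) ≡ bern quarter β
  avg-keep true  (true  , true ) true  = refl
  avg-keep true  (true  , false) true  = refl
  avg-keep true  (false , true ) true  = refl
  avg-keep true  (false , false) true  = refl
  avg-keep false (true  , true ) true  = refl
  avg-keep false (true  , false) true  = refl
  avg-keep false (false , true ) true  = refl
  avg-keep false (false , false) true  = refl
  avg-keep true  (true  , true ) false = refl
  avg-keep true  (true  , false) false = refl
  avg-keep true  (false , true ) false = refl
  avg-keep true  (false , false) false = refl
  avg-keep false (true  , true ) false = refl
  avg-keep false (true  , false) false = refl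
  avg-keep false (false , true ) false = refl
  avg-keep false (false , false) false = refl

patternIndicator : ∀ {n} → Bool → List (Edge n × Bool) → Labelling n → ℚ
patternIndicator b s a = 𝟙 (agrees (graphOf b a) s)

prGiven : ∀ {n} → Bool → List (Edge n × Bool) → ℚ
prGiven {n} b s = 𝔼 n (patternIndicator b s)

bernProd : ∀ {n} → List (Edge n × Bool) → ℚ
bernProd s = prodℚ (map (λ eb → bern quarter (proj₂ eb)) s)

graphOf-relabel : ∀ {n} b (a : Labelling n) {x} ℓ {e} → ¬ x ∈ₑ e →
  graphOf b (relabel a x ℓ) e ≡ graphOf b a e
graphOf-relabel b a ℓ {i , j , _} x∉e =
  cong₂ (keep b) (relabel-other a ℓ (x∉e ∘ inj₁)) (relabel-other a ℓ (x∉e ∘ inj₂))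

patternIndicator-relabel : ∀ {n} b (s : List (Edge n × Bool)) {x} → Fresh x (map proj₁ s) →
  ∀ a ℓ → patternIndicator b s (relabel a x ℓ) ≡ patternIndicator b s a
patternIndicator-relabel b s {x} x-fresh a ℓ =
  cong 𝟙 (agrees-cong {x = graphOf b (relabel a x ℓ)} {graphOf b a} s
           (All.map (λ {e} → graphOf-relabel b a {x} ℓ {e}) x-fresh))

prGiven-peel : ∀ {n} b {e : Edge n} {x v} β s → Joins e x v → Fresh x (map proj₁ s) →
  prGiven b ((e , β) ∷ s) ≡ bern quarter β * prGiven b s
prGiven-peel {n} b {e} {x} {v} β s J x-fresh =
  trans (𝔼-cong n split-first)
        (𝔼-factor n (λ ℓ ℓ' → 𝟙 (keep b ℓ ℓ' ≐ β)) (bern quarter β) (patternIndicator b s)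
                  (joins-≢ J) (λ c → avg-keep b c β) (patternIndicator-relabel b s x-fresh))
  where
  split-first : ∀ a → patternIndicator b ((e , β) ∷ s) a
                      ≡ 𝟙 (keep b (a x) (a v) ≐ β) * patternIndicator b s a
  split-first a = trans (𝟙-agrees-∷ (graphOf b a) e β s)
                        (cong (λ t → 𝟙 (t ≐ β) * patternIndicator b s a) (joins-graphOf J b a))

prGiven-swap : ∀ {n} b (p₁ p₂ : Edge n × Bool) s →
  prGiven b (p₁ ∷ p₂ ∷ s) ≡ prGiven b (p₂ ∷ p₁ ∷ s)
prGiven-swap {n} b p₁ p₂ s = 𝔼-cong n (λ a → 𝟙-agrees-swap (graphOf b a) p₁ p₂ s)

IndependentGiven : ∀ {n} → Bool → List (Edge n × Bool) → Set
IndependentGiven b s = prGiven b s ≡ bernProd s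

independent-[] : ∀ {n} b → IndependentGiven {n} b []
independent-[] {n} b = 𝔼-const n 1ℚ

independent-peel : ∀ {n} b {e : Edge n} {x v} β s → Joins e x v → Fresh x (map proj₁ s) →
  IndependentGiven b s → IndependentGiven b ((e , β) ∷ s)
independent-peel b β s J x-fresh ind =
  trans (prGiven-peel b β s J x-fresh) (cong (bern quarter β *_) ind)

independent-swap : ∀ {n} b (p₁ p₂ : Edge n × Bool) s →
  IndependentGiven b (p₂ ∷ p₁ ∷ s) → IndependentGiven b (p₁ ∷ p₂ ∷ s)
independent-swap b p₁ p₂ s ind =
  trans (prGiven-swap b p₁ p₂ s)
        (trans ind (x∙yz≈y∙xz (bern quarter (proj₂ p₂)) (bern quarter (proj₂ p₁)) (bernProd s)))

independent-single : ∀ {n} b (e : Edge n) β → IndependentGiven b ((e , β) ∷ [])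
independent-single {n} b (i , j , i<j) β =
  independent-peel b β [] (forward i<j) [] (independent-[] {n} b)

independent-pair : ∀ {n} b (e₁ e₂ : Edge n) β₁ β₂ → e₁ ≢ e₂ →
  IndependentGiven b ((e₁ , β₁) ∷ (e₂ , β₂) ∷ [])
independent-pair b e₁ e₂ β₁ β₂ e₁≢e₂ with distinct-pendant e₁ e₂ e₁≢e₂
... | _ , _ , J , x∉e₂ = independent-peel b β₁ _ J (x∉e₂ ∷ []) (independent-single b e₂ β₂)

threeQuarters : ℚ
threeQuarters = ℤ.+ 3 / 4

𝔼ᴹ : ∀ n → (Bool → Labelling n → ℚ) → ℚ
𝔼ᴹ n Φ = quarter * 𝔼 n (Φ true) + threeQuarters * 𝔼 n (Φ false)

𝔼ᴹ-given : ∀ n {Φ : Bool → Labelling n → ℚ} {c} → (∀ b → 𝔼 n (Φ b) ≡ c) → 𝔼ᴹ n Φ ≡ c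
𝔼ᴹ-given n {c = c} 𝔼Φ≡c =
  trans (cong₂ (λ s t → quarter * s + threeQuarters * t) (𝔼Φ≡c true) (𝔼Φ≡c false))
        (solve 1 (λ c → con quarter :* c :+ con threeQuarters :* c := c) refl c)

triangleIndicator : Bool → Bool → Bool → Bool → Label → Label → Label → ℚ
triangleIndicator b β₁ β₂ β₃ ℓ₁ ℓ₂ ℓ₃ =
  𝟙 (keep b ℓ₁ ℓ₂ ≐ β₁) * (𝟙 (keep b ℓ₂ ℓ₃ ≐ β₂) * (𝟙 (keep b ℓ₁ ℓ₃ ≐ β₃) * 1ℚ))

opaque
  unfolding avg

  triangle-mixture : ∀ β₁ β₂ β₃ →
    let pr b = avg (λ ℓ₁ → avg (λ ℓ₂ → avg (λ ℓ₃ → triangleIndicator b β₁ β₂ β₃ ℓ₁ ℓ₂ ℓ₃))) in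
    quarter * pr true + threeQuarters * pr false
      ≡ bern quarter β₁ * (bern quarter β₂ * (bern quarter β₃ * 1ℚ))
  triangle-mixture true  true  true  = refl
  triangle-mixture true  true  false = refl
  triangle-mixture true  false true  = refl
  triangle-mixture true  false false = refl
  triangle-mixture false true  true  = refl
  triangle-mixture false true  false = refl
  triangle-mixture false false true  = refl
  triangle-mixture false false false = refl

𝔼ᴹ-triangle : ∀ {n} {e₁ e₂ e₃ : Edge n} {x v y} β₁ β₂ β₃ →
  Joins e₁ x v → Joins e₂ v y → Joins e₃ x y →
  let s = (e₁ , β₁) ∷ (e₂ , β₂) ∷ (e₃ , β₃) ∷ [] in 𝔼ᴹ n (λ b → patternIndicator b s) ≡ bernProd s
𝔼ᴹ-triangle {n} {e₁} {e₂} {e₃} {x} {v} {y} β₁ β₂ β₃ J₁ J₂ J₃ =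
  trans (cong₂ (λ s t → quarter * s + threeQuarters * t) (given true) (given false))
        (triangle-mixture β₁ β₂ β₃)
  where
  s : List (Edge n × Bool)
  s = (e₁ , β₁) ∷ (e₂ , β₂) ∷ (e₃ , β₃) ∷ []
  pointwise : ∀ b a → patternIndicator b s a ≡ triangleIndicator b β₁ β₂ β₃ (a x) (a v) (a y)
  pointwise b a
    rewrite 𝟙-agrees-∷ (graphOf b a) e₁ β₁ ((e₂ , β₂) ∷ (e₃ , β₃) ∷ [])
          | 𝟙-agrees-∷ (graphOf b a) e₂ β₂ ((e₃ , β₃) ∷ [])
          | 𝟙-agrees-∷ (graphOf b a) e₃ β₃ []
          | joins-graphOf J₁ b a | joins-graphOf J₂ b a | joins-graphOf J₃ b a = refl
  given : ∀ b →
    prGiven b s ≡ avg (λ ℓ₁ → avg (λ ℓ₂ → avg (λ ℓ₃ → triangleIndicator b β₁ β₂ β₃ ℓ₁ ℓ₂ ℓ₃)))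
  given b = trans (𝔼-cong n (pointwise b))
                  (𝔼-three n (triangleIndicator b β₁ β₂ β₃) (joins-≢ J₁) (joins-≢ J₂) (joins-≢ J₃))

𝔼ᴹ-pattern : ∀ {n} (s : List (Edge n × Bool)) → Unique (map proj₁ s) → length s ℕ.≤ 3 →
  𝔼ᴹ n (λ b → patternIndicator b s) ≡ bernProd s
𝔼ᴹ-pattern {n} [] _ _ = 𝔼ᴹ-given n (independent-[] {n})
𝔼ᴹ-pattern {n} ((e , β) ∷ []) _ _ = 𝔼ᴹ-given n (λ b → independent-single b e β)
𝔼ᴹ-pattern {n} ((e₁ , β₁) ∷ (e₂ , β₂) ∷ []) ((e₁≢e₂ ∷ []) ∷ _) _ =
  𝔼ᴹ-given n (λ b → independent-pair b e₁ e₂ β₁ β₂ e₁≢e₂)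
𝔼ᴹ-pattern {n} ((e₁ , β₁) ∷ (e₂ , β₂) ∷ (e₃ , β₃) ∷ [])
           ((e₁≢e₂ ∷ e₁≢e₃ ∷ []) ∷ (e₂≢e₃ ∷ []) ∷ _) _
  with shape e₁ e₂ e₃ e₁≢e₂ e₁≢e₃
... | pendant₁ J x-fresh = 𝔼ᴹ-given n λ b →
  independent-peel b β₁ _ J x-fresh (independent-pair b e₂ e₃ β₂ β₃ e₂≢e₃)
... | pendant₂ J y-fresh = 𝔼ᴹ-given n λ b → independent-swap b (e₁ , β₁) (e₂ , β₂) ((e₃ , β₃) ∷ [])
  (independent-peel b β₂ _ J y-fresh (independent-pair b e₁ e₃ β₁ β₃ e₁≢e₃))
... | triangle J₁ J₂ J₃ = 𝔼ᴹ-triangle β₁ β₂ β₃ J₁ J₂ J₃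
𝔼ᴹ-pattern (_ ∷ _ ∷ _ ∷ _ ∷ _) _ (s≤s (s≤s (s≤s ())))

weightedSum : ∀ {A : Set} → List (ℚ × A) → (A → ℚ) → ℚ
weightedSum xs F = sumℚ (map (λ (w , x) → w * F x) xs)

weightedSum-++ : ∀ {A : Set} (xs ys : List (ℚ × A)) F →
  weightedSum (xs ++ ys) F ≡ weightedSum xs F + weightedSum ys F
weightedSum-++ []       ys F = sym (+-identityˡ _)
weightedSum-++ ((w , x) ∷ xs) ys F =
  trans (cong (w * F x +_) (weightedSum-++ xs ys F))
        (sym (+-assoc (w * F x) (weightedSum xs F) (weightedSum ys F)))

rescale : ∀ {A B : Set} → ℚ → (A → B) → List (ℚ × A) → List (ℚ × B)
rescale c h = map (Product.map (c *_) h)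

weightedSum-rescale : ∀ {A B : Set} c (h : A → B) xs F →
  weightedSum (rescale c h xs) F ≡ c * weightedSum xs (F ∘ h)
weightedSum-rescale c h []             F = sym (*-zeroʳ c)
weightedSum-rescale c h ((w , x) ∷ xs) F =
  trans (cong₂ _+_ (*-assoc c w (F (h x))) (weightedSum-rescale c h xs F))
        (sym (*-distribˡ-+ c (w * F (h x)) (weightedSum xs (F ∘ h))))

rescale-nonneg : ∀ {A B : Set} c .{{_ : NonNegative c}} (h : A → B) {xs} →
  All (λ p → 0ℚ ≤ proj₁ p) xs → All (λ p → 0ℚ ≤ proj₁ p) (rescale c h xs)
rescale-nonneg c h = map⁺ ∘ All.map (subst (_≤ c * _) (*-zeroʳ c) ∘ *-monoˡ-≤-nonNeg c)

prepend : ∀ {n} → Label → List (ℚ × Labelling n) → List (ℚ × Labelling (suc n))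
prepend ℓ = rescale quarter (ℓ ◂_)

uniform : ∀ n → List (ℚ × Labelling n)
uniform zero    = (1ℚ , ⟨⟩) ∷ []
uniform (suc n) = prepend ℓ₀₀ U ++ (prepend ℓ₀₁ U ++ (prepend ℓ₁₀ U ++ prepend ℓ₁₁ U))
  where
  U : List (ℚ × Labelling n)
  U = uniform n

uniform-nonneg : ∀ n → All (λ p → 0ℚ ≤ proj₁ p) (uniform n)
uniform-nonneg zero    = toWitness {a? = 0ℚ ≤? 1ℚ} _ ∷ []
uniform-nonneg (suc n) = ++⁺ (U ℓ₀₀) (++⁺ (U ℓ₀₁) (++⁺ (U ℓ₁₀) (U ℓ₁₁)))
  where
  U : ∀ ℓ → All (λ p → 0ℚ ≤ proj₁ p) (prepend ℓ (uniform n))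
  U ℓ = rescale-nonneg quarter (ℓ ◂_) (uniform-nonneg n)

opaque
  unfolding avg

  weightedSum-uniform : ∀ n F → weightedSum (uniform n) F ≡ 𝔼 n F
  weightedSum-uniform zero    F = trans (+-identityʳ _) (*-identityˡ (F ⟨⟩))
  weightedSum-uniform (suc n) F = begin
    weightedSum (U ℓ₀₀ ++ (U ℓ₀₁ ++ (U ℓ₁₀ ++ U ℓ₁₁))) F
      ≡⟨ trans (weightedSum-++ (U ℓ₀₀) _ F) (cong (S ℓ₀₀ +_)
         (trans (weightedSum-++ (U ℓ₀₁) _ F)
         (cong (S ℓ₀₁ +_) (weightedSum-++ (U ℓ₁₀) (U ℓ₁₁) F)))) ⟩
    S ℓ₀₀ + (S ℓ₀₁ + (S ℓ₁₀ + S ℓ₁₁))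
      ≡⟨ cong₂ _+_ (S≡ ℓ₀₀) (cong₂ _+_ (S≡ ℓ₀₁) (cong₂ _+_ (S≡ ℓ₁₀) (S≡ ℓ₁₁))) ⟩
    quarter * E ℓ₀₀ + (quarter * E ℓ₀₁ + (quarter * E ℓ₁₀ + quarter * E ℓ₁₁))
      ≡⟨ sym (distrib₄ (E ℓ₀₀) (E ℓ₀₁) (E ℓ₁₀) (E ℓ₁₁)) ⟩
    𝔼 (suc n) F ∎
    where
    open ≡-Reasoning
    U : Label → List (ℚ × Labelling (suc n))
    U ℓ = prepend ℓ (uniform n)
    S E : Label → ℚ
    S ℓ = weightedSum (U ℓ) F
    E ℓ = 𝔼 n (λ a → F (ℓ ◂ a))
    distrib₄ : ∀ a b c d →
      quarter * (a + (b + (c + d))) ≡ quarter * a + (quarter * b + (quarter * c + quarter * d))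
    distrib₄ = solve 4 (λ a b c d → con quarter :* (a :+ (b :+ (c :+ d)))
      := con quarter :* a :+ (con quarter :* b :+ (con quarter :* c :+ con quarter :* d))) refl
    S≡ : ∀ ℓ → S ℓ ≡ quarter * E ℓ
    S≡ ℓ = trans (weightedSum-rescale quarter (ℓ ◂_) (uniform n) F)
                 (cong (quarter *_) (weightedSum-uniform n (λ a → F (ℓ ◂ a))))

latent : ∀ n → List (ℚ × (Bool × Labelling n))
latent n = rescale quarter (true ,_) (uniform n) ++ rescale threeQuarters (false ,_) (uniform n)

weightedSum-latent : ∀ n (Φ : Bool → Labelling n → ℚ) →
  weightedSum (latent n) (uncurry Φ) ≡ 𝔼ᴹ n Φ
weightedSum-latent n Φ =
  trans (weightedSum-++ (rescale quarter (true ,_) (uniform n)) _ (uncurry Φ))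
        (cong₂ _+_ (given quarter true) (given threeQuarters false))
  where
  given : ∀ c b → weightedSum (rescale c (b ,_) (uniform n)) (uncurry Φ) ≡ c * 𝔼 n (Φ b)
  given c b = trans (weightedSum-rescale c (b ,_) (uniform n) (uncurry Φ))
                    (cong (c *_) (weightedSum-uniform n (Φ b)))

model : ∀ n → Dist n
model n = map (Product.map₂ (uncurry graphOf)) (latent n)

sum-model : ∀ n (f : ℚ × Outcome n → ℚ) (Φ : Bool → Labelling n → ℚ) →
  (∀ w b a → f (w , graphOf b a) ≡ w * Φ b a) → sumℚ (map f (model n)) ≡ 𝔼ᴹ n Φ
sum-model n f Φ f≡wΦ =
  trans (cong sumℚ (trans (sym (map-∘ (latent n)))
                          (map-cong (λ (w , b , a) → f≡wΦ w b a) (latent n))))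
        (weightedSum-latent n Φ)

if-then-0 : ∀ c w → (if c then w else 0ℚ) ≡ w * 𝟙 c
if-then-0 true  w = sym (*-identityʳ w)
if-then-0 false w = sym (*-zeroʳ w)

prAtLeast-map : ∀ {n} {A : Set} (xs : List (ℚ × A)) (g : A → Outcome n) (sel : A → Bool)
  {P : Outcome n → Set} {q} → (∀ x → sel x ≡ true → P (g x)) → q ≤ weightedSum xs (𝟙 ∘ sel) →
  PrAtLeast (map (Product.map₂ g) xs) P q
prAtLeast-map xs g sel {P} {q} sound q≤ =
  selected xs , selected-sound xs , subst (q ≤_) (sym (selected-sum xs)) q≤
  where
  selected : ∀ ys → Fin (length (map (Product.map₂ g) ys)) → Bool
  selected (y ∷ ys) zero    = sel (proj₂ y)
  selected (y ∷ ys) (suc i) = selected ys i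
  selected-sound : ∀ ys i → selected ys i ≡ true → P (proj₂ (lookup (map (Product.map₂ g) ys) i))
  selected-sound (y ∷ ys) zero    = sound (proj₂ y)
  selected-sound (y ∷ ys) (suc i) = selected-sound ys i
  selected-sum : ∀ ys →
    sumℚ (tabulate (λ i → if selected ys i then proj₁ (lookup (map (Product.map₂ g) ys) i) else 0ℚ))
      ≡ weightedSum ys (𝟙 ∘ sel)
  selected-sum []       = refl
  selected-sum (y ∷ ys) = cong₂ _+_ (if-then-0 (sel (proj₂ y)) (proj₁ y)) (selected-sum ys)

zConst : ∀ {n} → Bool → Labelling n → Bool
zConst {zero}  c a = true
zConst {suc n} c a = (proj₁ (head a) ≐ c) ∧ zConst c (tail a)

zVaries : ∀ {n} → Labelling n → Bool
zVaries a = not (zConst true a) ∧ not (zConst false a)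

zConst-intro : ∀ {n} c (a : Labelling n) → (∀ i → proj₁ (a i) ≡ c) → zConst c a ≡ true
zConst-intro {zero}  c a z≡c = refl
zConst-intro {suc n} c a z≡c rewrite z≡c zero =
  cong₂ _∧_ (≐-refl c) (zConst-intro c (tail a) (z≡c ∘ suc))
  where
  ≐-refl : ∀ c → (c ≐ c) ≡ true
  ≐-refl true  = refl
  ≐-refl false = refl

zConst⇒¬zVaries : ∀ {n} c (a : Labelling n) → zConst c a ≡ true → zVaries a ≡ false
zConst⇒¬zVaries true  a const rewrite const = refl
zConst⇒¬zVaries false a const rewrite const = ∧-zeroʳ (not (zConst true a))

reach⇒same-z : ∀ {n} b (a : Labelling n) {u v} →
  Reach (graphOf b a) u v → proj₁ (a u) ≡ proj₁ (a v)
reach⇒same-z b a here = refl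
reach⇒same-z b a (step {u} {v} (inj₁ (_ , kept)) r) =
  trans (keep⇒same-z b (a u) (a v) kept) (reach⇒same-z b a r)
reach⇒same-z b a (step {u} {v} (inj₂ (_ , kept)) r) =
  trans (sym (keep⇒same-z b (a v) (a u) kept)) (reach⇒same-z b a r)

zVaries⇒disconnected : ∀ {n} b (a : Labelling n) → zVaries a ≡ true → Disconnected (graphOf b a)
zVaries⇒disconnected {zero}  b a ()
zVaries⇒disconnected {suc n} b a varies connected =
  case trans (sym varies) (zConst⇒¬zVaries _ a (zConst-intro _ a z-is-z₀)) of λ ()
  where
  z-is-z₀ : ∀ i → proj₁ (a i) ≡ proj₁ (a zero)
  z-is-z₀ i = sym (reach⇒same-z b a (connected zero i))

opaque
  unfolding avg

  avg-same-z : ∀ c → avg (λ ℓ → 𝟙 (proj₁ ℓ ≐ c)) ≡ ½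
  avg-same-z true  = refl
  avg-same-z false = refl

𝔼-zConst : ∀ n c → 𝔼 n (λ a → 𝟙 (zConst c a)) ≡ half^ n
𝔼-zConst zero    c = refl
𝔼-zConst (suc n) c = begin
  avg (λ ℓ → 𝔼 n (λ a → 𝟙 ((proj₁ ℓ ≐ c) ∧ zConst c a)))  ≡⟨ avg-cong factor ⟩
  avg (λ ℓ → Z ℓ * half^ n)                                ≡⟨ avg-*ʳ Z (half^ n) ⟩
  avg Z * half^ n                                          ≡⟨ cong (_* half^ n) (avg-same-z c) ⟩
  ½ * half^ n                                              ∎
  where
  open ≡-Reasoning
  Z : Label → ℚ
  Z ℓ = 𝟙 (proj₁ ℓ ≐ c)
  factor : ∀ ℓ → 𝔼 n (λ a → 𝟙 ((proj₁ ℓ ≐ c) ∧ zConst c a)) ≡ Z ℓ * half^ n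
  factor ℓ = trans (𝔼-cong n (λ a → 𝟙-∧ (proj₁ ℓ ≐ c) (zConst c a)))
            (trans (𝔼-*ˡ n (Z ℓ) (λ a → 𝟙 (zConst c a))) (cong (Z ℓ *_) (𝔼-zConst n c)))

zVaries-partition : ∀ {n} (a : Labelling (suc n)) →
  𝟙 (zVaries a) + 𝟙 (zConst true a) + 𝟙 (zConst false a) ≡ 1ℚ
zVaries-partition a = partition (proj₁ (head a)) (zConst true (tail a)) (zConst false (tail a))
  where
  partition : ∀ z t f →
    𝟙 (not ((z ≐ true) ∧ t) ∧ not ((z ≐ false) ∧ f)) + 𝟙 ((z ≐ true) ∧ t) + 𝟙 ((z ≐ false) ∧ f) ≡ 1ℚ
  partition true  true  _     = refl
  partition true  false _     = refl
  partition false _     true  = refl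
  partition false _     false = refl

𝔼-zVaries : ∀ n → bound n ≤ 𝔼 n (λ a → 𝟙 (zVaries a))
𝔼-zVaries zero    = toWitness {a? = bound 0 ≤? 0ℚ} _
𝔼-zVaries (suc m) = ≤-reflexive (begin
  1ℚ - two * h                          ≡⟨ cong (λ t → t - two * h) total ⟨
  𝔼 (suc m) V + h + h - two * h          ≡⟨ cancel (𝔼 (suc m) V) h ⟩
  𝔼 (suc m) V                           ∎)
  where
  open ≡-Reasoning
  two h : ℚ
  two = ℤ.+ 2 / 1
  h = half^ (suc m)
  V T F : Labelling (suc m) → ℚ
  V a = 𝟙 (zVaries a)
  T a = 𝟙 (zConst true a)
  F a = 𝟙 (zConst false a)
  cancel : ∀ x h → x + h + h - two * h ≡ x
  cancel = solve 2 (λ x h → x :+ h :+ h :- con two :* h := x) refl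
  total : 𝔼 (suc m) V + h + h ≡ 1ℚ
  total = begin
    𝔼 (suc m) V + h + h                      ≡⟨ cong₂ (λ s t → 𝔼 (suc m) V + s + t)
                                                  (𝔼-zConst (suc m) true) (𝔼-zConst (suc m) false) ⟨
    𝔼 (suc m) V + 𝔼 (suc m) T + 𝔼 (suc m) F  ≡⟨ cong (_+ 𝔼 (suc m) F) (𝔼-+ (suc m) V T) ⟨
    𝔼 (suc m) (λ a → V a + T a) + 𝔼 (suc m) F ≡⟨ 𝔼-+ (suc m) (λ a → V a + T a) F ⟨
    𝔼 (suc m) (λ a → V a + T a + F a)        ≡⟨ 𝔼-cong (suc m) zVaries-partition ⟩
    𝔼 (suc m) (λ _ → 1ℚ)                     ≡⟨ 𝔼-const (suc m) 1ℚ ⟩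
    1ℚ                                        ∎

model-isDistribution : ∀ n → IsDistribution (model n)
model-isDistribution n =
  map⁺ (++⁺ (rescale-nonneg quarter (true ,_) (uniform-nonneg n))
            (rescale-nonneg threeQuarters (false ,_) (uniform-nonneg n))) ,
  trans (sum-model n proj₁ (λ _ _ → 1ℚ) (λ w _ _ → sym (*-identityʳ w)))
        (𝔼ᴹ-given n (λ _ → 𝔼-const n 1ℚ))

model-3-wise : ∀ n → KWiseIndependent 3 quarter (model n)
model-3-wise n s unique |s|≤3 =
  trans (sum-model n _ (λ b → patternIndicator b s)
                   (λ w b a → if-then-0 (agrees (graphOf b a) s) w))
        (𝔼ᴹ-pattern s unique |s|≤3)

model-disconnected : ∀ n → PrAtLeast (model n) Disconnected (bound n)
model-disconnected n =
  prAtLeast-map (latent n) (uncurry graphOf) (zVaries ∘ proj₂) {P = Disconnected}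
    (λ (b , a) → zVaries⇒disconnected b a) (subst (bound n ≤_) (sym weight) (𝔼-zVaries n))
  where
  weight : weightedSum (latent n) (λ (_ , a) → 𝟙 (zVaries a)) ≡ 𝔼 n (λ a → 𝟙 (zVaries a))
  weight = trans (weightedSum-latent n (λ _ a → 𝟙 (zVaries a))) (𝔼ᴹ-given n (λ _ → refl))

lemma4p7 : (n : ℕ) →
    Σ[ D ∈ Dist n ]
      IsDistribution D
      × KWiseIndependent 3 quarter D
      × PrAtLeast D Disconnected (bound n)
lemma4p7 n = model n , model-isDistribution n , model-3-wise n , model-disconnected n
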